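{- For every formula $F$ of the language of intuitionistic epistemic logic: if $\mathsf{IEL}^-\vdash F$ then there is a normal realisation $r$ with $\mathsf{LPV}^-\vdash (tr(F))^r$; and if $\mathsf{IEL}\vdash F$ then there is a normal realisation $r$ with $\mathsf{LPV}\vdash (tr(F))^r$. (That is, every theorem of $\mathsf{IEL}^-$, resp. $\mathsf{IEL}$, is proof realisable.)
   Context: $\mathsf{IEL}^-$: in the language of intuitionistic propositional logic ($\bot,\land,\lor,\rightarrow$, with $\neg A:=A\rightarrow\bot$) plus a unary operator ${\bf K}$; axioms: axioms of intuitionistic propositional logic, ${\bf K}(A\rightarrow B)\rightarrow({\bf K}A\rightarrow{\bf K}B)$, $A\rightarrow{\bf K}A$; rule: Modus Ponens. $\mathsf{IEL}$ is $\mathsf{IEL}^-$ plus ${\bf K}A\rightarrow\neg\neg A$. Gödel translation $tr$ ("box every subformula") into the classical bimodal language with $\Box$ and ${\bf V}$: $tr(p)=\Box p$, $tr(\bot)=\Box\bot$, $tr(A\circ B)=\Box(tr(A)\circ tr(B))$ for $\circ\in\{\land,\lor,\rightarrow\}$, $tr(\neg A)=\Box\neg tr(A)$, $tr({\bf K}A)=\Box{\bf V}\,tr(A)$. $\mathsf{LPV}^-$: language of classical propositional logic extended by ${\bf V}A$ and $t{:}A$, with proof terms built from proof variables and proof constants by binary $\cdot$, $+$ and unary $!$. Axioms: classical propositional tautologies; $t{:}(A\rightarrow B)\rightarrow(s{:}A\rightarrow (t\cdot s){:}B)$; $t{:}A\rightarrow A$; $t{:}A\rightarrow\, !t{:}t{:}A$;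 $t{:}A\rightarrow (s+t){:}A$, $t{:}A\rightarrow (t+s){:}A$; ${\bf V}(A\rightarrow B)\rightarrow({\bf V}A\rightarrow {\bf V}B)$; $t{:}A\rightarrow {\bf V}A$. Rules: Modus Ponens and Axiom Necessitation (from an axiom $A$ infer $c{:}A$, $c$ a proof constant). $\mathsf{LPV}$ adds the axiom $\neg t{:}{\bf V}\bot$. A realisation $r$ of a formula $G$ in the language with $\Box,{\bf V}$ replaces each occurrence of $\Box$ by a proof term (so $\Box H$ becomes $t{:}H^r$). Polarity of occurrences of $\Box$: an occurrence in $F$ keeps its polarity in $G\rightarrow F$, $F\land G$, $G\land F$, $F\lor G$, $G\lor F$, $\Box F$ and reverses it in $F\rightarrow G$, $\neg F$; the outermost occurrence in a formula $\Box H$ is positive. A realisation is normal if every negative occurrence of $\Box$ is replaced by a proof variable. A formula $F$ of $\mathsf{IEL}^-$ (resp. $\mathsf{IEL}$) is proof realisable if $(tr(F))^r$ is valid in (a theorem of) $\mathsf{LPV}^-$ (resp. $\mathsf{LPV}$) for some normal realisation $r$. -}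

module Defs where

open import Data.Nat using (ℕ)
open import Data.Bool using (Bool; true; false; _∧_; _∨_; not)
open import Data.Product using (Σ; _×_; _,_)
open import Relation.Binary.PropositionalEquality using (_≡_)

infixr 6 _∧ᵢ_
infixr 5 _∨ᵢ_
infixr 4 _⇒ᵢ_

data IForm : Set where
  varᵢ  : ℕ → IForm
  ⊥ᵢ    : IForm
  _∧ᵢ_  : IForm → IForm → IForm
  _∨ᵢ_  : IForm → IForm → IForm
  _⇒ᵢ_  : IForm → IForm → IForm
  Kᵢ    : IForm → IForm

¬ᵢ_ : IForm → IForm
¬ᵢ A = A ⇒ᵢ ⊥ᵢ

-- Hilbert axioms; the Boolean flag says whether the axiom K A → ¬¬A
-- (i.e. IEL rather than IEL⁻) is available.
data IAx : Bool → IForm → Set where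
  ax-K   : ∀ {b} A B → IAx b (A ⇒ᵢ (B ⇒ᵢ A))
  ax-S   : ∀ {b} A B C → IAx b ((A ⇒ᵢ (B ⇒ᵢ C)) ⇒ᵢ ((A ⇒ᵢ B) ⇒ᵢ (A ⇒ᵢ C)))
  ax-∧E₁ : ∀ {b} A B → IAx b ((A ∧ᵢ B) ⇒ᵢ A)
  ax-∧E₂ : ∀ {b} A B → IAx b ((A ∧ᵢ B) ⇒ᵢ B)
  ax-∧I  : ∀ {b} A B → IAx b (A ⇒ᵢ (B ⇒ᵢ (A ∧ᵢ B)))
  ax-∨I₁ : ∀ {b} A B → IAx b (A ⇒ᵢ (A ∨ᵢ B))
  ax-∨I₂ : ∀ {b} A B → IAx b (B ⇒ᵢ (A ∨ᵢ B))
  ax-∨E  : ∀ {b} A B C → IAx b ((A ⇒ᵢ C) ⇒ᵢ ((B ⇒ᵢ C) ⇒ᵢ ((A ∨ᵢ B) ⇒ᵢ C)))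
  ax-⊥E  : ∀ {b} A → IAx b (⊥ᵢ ⇒ᵢ A)
  ax-Kdist : ∀ {b} A B → IAx b (Kᵢ (A ⇒ᵢ B) ⇒ᵢ (Kᵢ A ⇒ᵢ Kᵢ B))
  ax-co    : ∀ {b} A → IAx b (A ⇒ᵢ Kᵢ A)
  ax-refl  : ∀ A → IAx true (Kᵢ A ⇒ᵢ ¬ᵢ ¬ᵢ A)

data _⊢ᵢ_ (withRefl : Bool) : IForm → Set where
  ax : ∀ {A} → IAx withRefl A → withRefl ⊢ᵢ A
  mp : ∀ {A B} → withRefl ⊢ᵢ (A ⇒ᵢ B) → withRefl ⊢ᵢ A → withRefl ⊢ᵢ B

IEL⁻⊢_ : IForm → Set
IEL⁻⊢ A = false ⊢ᵢ A

IEL⊢_ : IForm → Set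
IEL⊢ A = true ⊢ᵢ A

data BForm : Set where
  varᵦ : ℕ → BForm
  ⊥ᵦ   : BForm
  _∧ᵦ_ : BForm → BForm → BForm
  _∨ᵦ_ : BForm → BForm → BForm
  _⇒ᵦ_ : BForm → BForm → BForm
  □ᵦ   : BForm → BForm
  Vᵦ   : BForm → BForm

¬ᵦ_ : BForm → BForm
¬ᵦ A = A ⇒ᵦ ⊥ᵦ

-- Gödel translation "box every subformula".  The clause for ¬A = A → ⊥
-- is the explicit clause tr(¬A) = □¬tr(A).
tr : IForm → BForm
tr (varᵢ p)       = □ᵦ (varᵦ p)
tr ⊥ᵢ             = □ᵦ ⊥ᵦ
tr (A ∧ᵢ B)       = □ᵦ (tr A ∧ᵦ tr B)
tr (A ∨ᵢ B)       = □ᵦ (tr A ∨ᵦ tr B)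
tr (A ⇒ᵢ ⊥ᵢ)      = □ᵦ (¬ᵦ tr A)
tr (A ⇒ᵢ varᵢ p)  = □ᵦ (tr A ⇒ᵦ tr (varᵢ p))
tr (A ⇒ᵢ (B ∧ᵢ C)) = □ᵦ (tr A ⇒ᵦ tr (B ∧ᵢ C))
tr (A ⇒ᵢ (B ∨ᵢ C)) = □ᵦ (tr A ⇒ᵦ tr (B ∨ᵢ C))
tr (A ⇒ᵢ (B ⇒ᵢ C)) = □ᵦ (tr A ⇒ᵦ tr (B ⇒ᵢ C))
tr (A ⇒ᵢ Kᵢ B)    = □ᵦ (tr A ⇒ᵦ tr (Kᵢ B))
tr (Kᵢ A)         = □ᵦ (Vᵦ (tr A))

infixl 8 _·_
infixl 7 _+ₜ_

data Term : Set where
  pvar   : ℕ → Term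
  pconst : ℕ → Term
  _·_    : Term → Term → Term
  _+ₜ_   : Term → Term → Term
  !_     : Term → Term

infix 9 _∶_

data LForm : Set where
  varₗ : ℕ → LForm
  ⊥ₗ   : LForm
  _∧ₗ_ : LForm → LForm → LForm
  _∨ₗ_ : LForm → LForm → LForm
  _⇒ₗ_ : LForm → LForm → LForm
  Vₗ   : LForm → LForm
  _∶_  : Term → LForm → LForm

¬ₗ_ : LForm → LForm
¬ₗ A = A ⇒ₗ ⊥ₗ

-- Boolean evaluation, treating p, V A and t:A as propositional atoms.
eval : (LForm → Bool) → LForm → Bool
eval v (varₗ p)  = v (varₗ p)
eval v ⊥ₗ        = false
eval v (A ∧ₗ B)  = eval v A ∧ eval v B
eval v (A ∨ₗ B)  = eval v A ∨ eval v B
eval v (A ⇒ₗ B)  = not (eval v A) ∨ eval v B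
eval v (Vₗ A)    = v (Vₗ A)
eval v (t ∶ A)   = v (t ∶ A)

Tautology : LForm → Set
Tautology A = ∀ (v : LForm → Bool) → eval v A ≡ true

data LAx : Bool → LForm → Set where
  ax-taut : ∀ {b A} → Tautology A → LAx b A
  ax-app  : ∀ {b} t s A B → LAx b ((t ∶ (A ⇒ₗ B)) ⇒ₗ ((s ∶ A) ⇒ₗ ((t · s) ∶ B)))
  ax-refl : ∀ {b} t A → LAx b ((t ∶ A) ⇒ₗ A)
  ax-!    : ∀ {b} t A → LAx b ((t ∶ A) ⇒ₗ ((! t) ∶ (t ∶ A)))
  ax-+l   : ∀ {b} s t A → LAx b ((t ∶ A) ⇒ₗ ((s +ₜ t) ∶ A))
  ax-+r   : ∀ {b} s t A → LAx b ((t ∶ A) ⇒ₗ ((t +ₜ s) ∶ A))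
  ax-Vdist : ∀ {b} A B → LAx b (Vₗ (A ⇒ₗ B) ⇒ₗ (Vₗ A ⇒ₗ Vₗ B))
  ax-V    : ∀ {b} t A → LAx b ((t ∶ A) ⇒ₗ Vₗ A)
  ax-cons : ∀ t → LAx true (¬ₗ (t ∶ Vₗ ⊥ₗ))

data _⊢ₗ_ (withCons : Bool) : LForm → Set where
  ax  : ∀ {A} → LAx withCons A → withCons ⊢ₗ A
  mp  : ∀ {A B} → withCons ⊢ₗ (A ⇒ₗ B) → withCons ⊢ₗ A → withCons ⊢ₗ B
  nec : ∀ {A} → LAx withCons A → (c : ℕ) → withCons ⊢ₗ (pconst c ∶ A)

LPV⁻⊢_ : LForm → Set
LPV⁻⊢ A = false ⊢ₗ A

LPV⊢_ : LForm → Set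
LPV⊢ A = true ⊢ₗ A

-- NormalRealisation π G G' : G' is obtained from G (occurring at polarity π)
-- by replacing each occurrence of □ by a proof term, each negative
-- occurrence being replaced by a proof variable.

data Pol : Set where
  pos neg : Pol

flip : Pol → Pol
flip pos = neg
flip neg = pos

data NormalRealisation : Pol → BForm → LForm → Set where
  r-var : ∀ {π} p → NormalRealisation π (varᵦ p) (varₗ p)
  r-⊥   : ∀ {π} → NormalRealisation π ⊥ᵦ ⊥ₗ
  r-∧   : ∀ {π A A' B B'} → NormalRealisation π A A' → NormalRealisation π B B'
          → NormalRealisation π (A ∧ᵦ B) (A' ∧ₗ B')
  r-∨   : ∀ {π A A' B B'} → NormalRealisation π A A' → NormalRealisation π B B'
          → NormalRealisation π (A ∨ᵦ B) (A' ∨ₗ B')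
  r-⇒   : ∀ {π A A' B B'} → NormalRealisation (flip π) A A' → NormalRealisation π B B'
          → NormalRealisation π (A ⇒ᵦ B) (A' ⇒ₗ B')
  r-V   : ∀ {π A A'} → NormalRealisation π A A' → NormalRealisation π (Vᵦ A) (Vₗ A')
  r-□pos : ∀ {A A'} → (t : Term) → NormalRealisation pos A A'
          → NormalRealisation pos (□ᵦ A) (t ∶ A')
  r-□neg : ∀ {A A'} → (x : ℕ) → NormalRealisation neg A A'
          → NormalRealisation neg (□ᵦ A) (pvar x ∶ A')

ProofRealisable⁻ : IForm → Set
ProofRealisable⁻ F = Σ LForm λ G → NormalRealisation pos (tr F) G × (LPV⁻⊢ G)

ProofRealisable : IForm → Set
ProofRealisable F = Σ LForm λ G → NormalRealisation pos (tr F) G × (LPV⊢ G)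

module Submission where

-- As in the paper, the realisation goes through a cut-free sequent calculus.
-- Finally we realise cut-free derivations uniformly: every negative □ becomes
-- the proof variable x₀ and every positive □ one term T, a sequent Γ ⇒ C
-- becoming  ⋀Γ⁻ → C⁺.  Each derivation yields a proof term of that formula
-- which does not depend on T, valid whenever a certain term (built from the
-- subderivations) is a summand of T.  Taking T to be the root's term closes
-- the loop, and the empty antecedent gives (tr F)^r itself.

open import Defs
open import Data.Bool using (Bool; true; false; _∧_; _∨_; not) renaming (T to IsTrue)
open import Data.Bool.Properties using (T-≡; T-∧)
open import Data.Nat using (ℕ; zero; suc; _+_)
open import Data.Fin using (Fin; #_)
open import Data.Vec using (Vec; []; _∷_; lookup; map)
open import Data.Vec.Properties using (lookup-map)
open import Data.List using (List; []; _∷_; _++_)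
open import Data.List.Membership.Propositional using (_∈_)
open import Data.List.Membership.Propositional.Properties using (∈-++⁻)
open import Data.List.Relation.Unary.Any using (here; there)
open import Data.List.Relation.Binary.Subset.Propositional using (_⊆_)
open import Data.List.Relation.Binary.Subset.Propositional.Properties
  using (⊆-refl; ⊆-trans; ∷⁺ʳ; ++⁺; xs⊆ys++xs; xs⊆xs++ys; ⊆-reflexive-↭)
open import Data.List.Relation.Binary.Permutation.Propositional using (↭-refl; ↭-prep; ↭-swap; ↭-trans)
open import Data.List.Relation.Binary.Permutation.Propositional.Properties using (shift)
open import Data.Product using (Σ; _×_; _,_; proj₁; proj₂)
open import Data.Sum using (inj₁; inj₂)
open import Data.Unit using (⊤; tt)
open import Function.Bundles using (Equivalence)
open import Relation.Binary.PropositionalEquality using (_≡_; refl; subst; sym; cong; cong₂; trans)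

private variable
  b : Bool
  n d k : ℕ
  A B C : IForm
  Γ Γ₁ Δ : List IForm
  G P Q R : LForm
  S T s t w : Term

there⊆ : Γ ⊆ Δ → Γ ⊆ A ∷ Δ
there⊆ s m = there (s m)

⊆-skip : Γ ⊆ A ∷ Γ
⊆-skip = there⊆ ⊆-refl

⊆-skip₂ : Γ ⊆ A ∷ B ∷ Γ
⊆-skip₂ = there⊆ ⊆-skip

keep₂ : Γ ⊆ Δ → A ∷ B ∷ Γ ⊆ A ∷ B ∷ Δ
keep₂ s = ∷⁺ʳ _ (∷⁺ʳ _ s)

exchange : A ∷ B ∷ Γ ⊆ B ∷ A ∷ Γ
exchange = ⊆-reflexive-↭ (↭-swap _ _ ↭-refl)

known : List IForm → List IForm
known []          = []
known (Kᵢ A ∷ Γ) = A ∷ known Γ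
known (_ ∷ Γ)     = known Γ

-- Γ ⁺ = known Γ , Γ : the context of the premise of the K-rules.
_⁺ : List IForm → List IForm
Γ ⁺ = known Γ ++ Γ

data KView : IForm → Set where
  isK  : ∀ A → KView (Kᵢ A)
  notK : (∀ Γ → known (B ∷ Γ) ≡ known Γ) → KView B

kview : ∀ B → KView B
kview (Kᵢ A)   = isK A
kview (varᵢ _) = notK λ _ → refl
kview ⊥ᵢ       = notK λ _ → refl
kview (_ ∧ᵢ _) = notK λ _ → refl
kview (_ ∨ᵢ _) = notK λ _ → refl
kview (_ ⇒ᵢ _) = notK λ _ → refl

known⁻ : ∀ Γ → A ∈ known Γ → Kᵢ A ∈ Γ
known⁻ (B ∷ Γ) m with kview B | m
... | isK _   | here refl = here refl
... | isK _   | there m′  = there (known⁻ Γ m′)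
... | notK eq | _         = there (known⁻ Γ (subst (_ ∈_) (eq Γ) m))

known⁺ : ∀ Γ → Kᵢ A ∈ Γ → A ∈ known Γ
known⁺ (_ ∷ Γ) (here refl) = here refl
known⁺ (B ∷ Γ) (there m) with kview B
... | isK _   = there (known⁺ Γ m)
... | notK eq = subst (_ ∈_) (sym (eq Γ)) (known⁺ Γ m)

known-mono : Γ ⊆ Δ → known Γ ⊆ known Δ
known-mono {Γ} {Δ} s m = known⁺ Δ (s (known⁻ Γ m))

⁺-mono : Γ ⊆ Δ → Γ ⁺ ⊆ Δ ⁺
⁺-mono s = ++⁺ (known-mono s) s

⊆⁺ : Γ ⊆ Γ ⁺
⊆⁺ {Γ} = xs⊆ys++xs Γ (known Γ)

⁺-cons : (∀ Θ → known (A ∷ Θ) ≡ known Θ) → (A ∷ Γ) ⁺ ⊆ A ∷ Γ ⁺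
⁺-cons {A} {Γ} eq rewrite eq Γ = ⊆-reflexive-↭ (shift A (known Γ) Γ)

⁺-consK : (Kᵢ A ∷ Γ) ⁺ ⊆ Kᵢ A ∷ A ∷ Γ ⁺
⁺-consK {A} {Γ} =
  ⊆-reflexive-↭ (↭-trans (↭-prep A (shift (Kᵢ A) (known Γ) Γ)) (↭-swap A (Kᵢ A) ↭-refl))

-- Cut-free sequent calculus for IEL⁻ (flag false) and IEL (flag true).
-- Contexts are lists; exchange and contraction are built into the
-- membership side conditions of the left rules.
infix 2 _∣_⊢ₛ_

data _∣_⊢ₛ_ (b : Bool) : List IForm → IForm → Set where
  init : ∀ {p} → varᵢ p ∈ Γ → b ∣ Γ ⊢ₛ varᵢ p
  ⊥L   : ⊥ᵢ ∈ Γ → b ∣ Γ ⊢ₛ C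
  ∧R   : b ∣ Γ ⊢ₛ A → b ∣ Γ ⊢ₛ B → b ∣ Γ ⊢ₛ A ∧ᵢ B
  ∧L   : (A ∧ᵢ B) ∈ Γ → b ∣ A ∷ B ∷ Γ ⊢ₛ C → b ∣ Γ ⊢ₛ C
  ∨R₁  : b ∣ Γ ⊢ₛ A → b ∣ Γ ⊢ₛ A ∨ᵢ B
  ∨R₂  : b ∣ Γ ⊢ₛ B → b ∣ Γ ⊢ₛ A ∨ᵢ B
  ∨L   : (A ∨ᵢ B) ∈ Γ → b ∣ A ∷ Γ ⊢ₛ C → b ∣ B ∷ Γ ⊢ₛ C → b ∣ Γ ⊢ₛ C
  ⇒R   : b ∣ A ∷ Γ ⊢ₛ B → b ∣ Γ ⊢ₛ A ⇒ᵢ B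
  ⇒L   : (A ⇒ᵢ B) ∈ Γ → b ∣ Γ ⊢ₛ A → b ∣ B ∷ Γ ⊢ₛ C → b ∣ Γ ⊢ₛ C
  -- from  known Γ, Γ ⇒ A  infer  Γ ⇒ K A   (distribution and co-reflection)
  KR   : b ∣ Γ ⁺ ⊢ₛ A → b ∣ Γ ⊢ₛ Kᵢ A
  -- IEL only: from  known Γ, Γ ⇒ ⊥  infer  Γ ⇒ C   (K A → ¬¬A)
  K⊥   : b ≡ true → b ∣ Γ ⁺ ⊢ₛ ⊥ᵢ → b ∣ Γ ⊢ₛ C

weaken : Γ ⊆ Δ → b ∣ Γ ⊢ₛ C → b ∣ Δ ⊢ₛ C
weaken s (init m)    = init (s m)
weaken s (⊥L m)      = ⊥L (s m)
weaken s (∧R d e)    = ∧R (weaken s d) (weaken s e)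
weaken s (∧L m d)    = ∧L (s m) (weaken (keep₂ s) d)
weaken s (∨R₁ d)     = ∨R₁ (weaken s d)
weaken s (∨R₂ d)     = ∨R₂ (weaken s d)
weaken s (∨L m d e)  = ∨L (s m) (weaken (∷⁺ʳ _ s) d) (weaken (∷⁺ʳ _ s) e)
weaken s (⇒R d)      = ⇒R (weaken (∷⁺ʳ _ s) d)
weaken s (⇒L m d e)  = ⇒L (s m) (weaken s d) (weaken (∷⁺ʳ _ s) e)
weaken s (KR d)      = KR (weaken (⁺-mono s) d)
weaken s (K⊥ eq d)   = K⊥ eq (weaken (⁺-mono s) d)

identity : ∀ A → A ∈ Γ → b ∣ Γ ⊢ₛ A
identity (varᵢ p) m = init m
identity ⊥ᵢ       m = ⊥L m
identity (A ∧ᵢ B) m = ∧L m (∧R (identity A (here refl)) (identity B (there (here refl))))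
identity (A ∨ᵢ B) m = ∨L m (∨R₁ (identity A (here refl))) (∨R₂ (identity B (here refl)))
identity (A ⇒ᵢ B) m = ⇒R (⇒L (there m) (identity A (here refl)) (identity B (here refl)))
identity {Γ = Γ} (Kᵢ A) m = KR (identity A (xs⊆xs++ys (known Γ) Γ (known⁺ Γ m)))

-- A derivation of ⊥ can replace any conclusion: ⊥ only ever arises from ⊥L/K⊥.
from⊥ : b ∣ Γ₁ ⊢ₛ ⊥ᵢ → Γ₁ ⊆ Γ → b ∣ Γ ⊢ₛ C
from⊥ (⊥L m)      s = ⊥L (s m)
from⊥ (∧L m d)    s = ∧L (s m) (from⊥ d (keep₂ s))
from⊥ (∨L m d e)  s = ∨L (s m) (from⊥ d (∷⁺ʳ _ s)) (from⊥ e (∷⁺ʳ _ s))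
from⊥ (⇒L m d e)  s = ⇒L (s m) (weaken s d) (from⊥ e (∷⁺ʳ _ s))
from⊥ (K⊥ eq d)   s = K⊥ eq (weaken (⁺-mono s) d)

-- Admissibility of cut on A, with weakening of both premises built in.
CutFor : Bool → IForm → Set
CutFor b A = ∀ {Γ₁ Γ Δ C} → b ∣ Γ₁ ⊢ₛ A → b ∣ Δ ⊢ₛ C → Γ₁ ⊆ Γ → Δ ⊆ A ∷ Γ → b ∣ Γ ⊢ₛ C

SubCuts : Bool → IForm → Set
SubCuts b (A ∧ᵢ B) = CutFor b A × CutFor b B
SubCuts b (A ∨ᵢ B) = CutFor b A × CutFor b B
SubCuts b (A ⇒ᵢ B) = CutFor b A × CutFor b B
SubCuts b (Kᵢ A)   = CutFor b A
SubCuts b _        = ⊤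

-- To cut a principal formula A ∘ B we analyse the left
-- premise: left rules and ⊥L/K⊥ commute with the cut, while the right rule
-- introducing A ∘ B is reduced to cuts on A and B.
invert∧ : CutFor b A → CutFor b B → b ∣ Γ₁ ⊢ₛ A ∧ᵢ B
        → b ∣ A ∷ B ∷ Γ ⊢ₛ C → Γ₁ ⊆ Γ → b ∣ Γ ⊢ₛ C
invert∧ cutA cutB (∧R a e)   r s = cutA a (cutB e r (there⊆ s) exchange) s ⊆-refl
invert∧ cutA cutB (⊥L m)     r s = ⊥L (s m)
invert∧ cutA cutB (∧L m d)   r s = ∧L (s m) (invert∧ cutA cutB d (weaken (keep₂ ⊆-skip₂) r) (keep₂ s))
invert∧ cutA cutB (∨L m d e) r s =
  ∨L (s m) (invert∧ cutA cutB d (weaken (keep₂ ⊆-skip) r) (∷⁺ʳ _ s))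
           (invert∧ cutA cutB e (weaken (keep₂ ⊆-skip) r) (∷⁺ʳ _ s))
invert∧ cutA cutB (⇒L m d e) r s =
  ⇒L (s m) (weaken s d) (invert∧ cutA cutB e (weaken (keep₂ ⊆-skip) r) (∷⁺ʳ _ s))
invert∧ cutA cutB (K⊥ eq d)  r s = K⊥ eq (weaken (⁺-mono s) d)

invert∨ : CutFor b A → CutFor b B → b ∣ Γ₁ ⊢ₛ A ∨ᵢ B
        → b ∣ A ∷ Γ ⊢ₛ C → b ∣ B ∷ Γ ⊢ₛ C → Γ₁ ⊆ Γ → b ∣ Γ ⊢ₛ C
invert∨ cutA cutB (∨R₁ a)    r₁ r₂ s = cutA a r₁ s ⊆-refl
invert∨ cutA cutB (∨R₂ a)    r₁ r₂ s = cutB a r₂ s ⊆-refl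
invert∨ cutA cutB (⊥L m)     r₁ r₂ s = ⊥L (s m)
invert∨ cutA cutB (∧L m d)   r₁ r₂ s =
  ∧L (s m) (invert∨ cutA cutB d (weaken (∷⁺ʳ _ ⊆-skip₂) r₁) (weaken (∷⁺ʳ _ ⊆-skip₂) r₂) (keep₂ s))
invert∨ cutA cutB (∨L m d e) r₁ r₂ s =
  ∨L (s m) (invert∨ cutA cutB d (weaken (∷⁺ʳ _ ⊆-skip) r₁) (weaken (∷⁺ʳ _ ⊆-skip) r₂) (∷⁺ʳ _ s))
           (invert∨ cutA cutB e (weaken (∷⁺ʳ _ ⊆-skip) r₁) (weaken (∷⁺ʳ _ ⊆-skip) r₂) (∷⁺ʳ _ s))
invert∨ cutA cutB (⇒L m d e) r₁ r₂ s =
  ⇒L (s m) (weaken s d)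
     (invert∨ cutA cutB e (weaken (∷⁺ʳ _ ⊆-skip) r₁) (weaken (∷⁺ʳ _ ⊆-skip) r₂) (∷⁺ʳ _ s))
invert∨ cutA cutB (K⊥ eq d)  r₁ r₂ s = K⊥ eq (weaken (⁺-mono s) d)

invert⇒ : CutFor b A → CutFor b B → b ∣ Γ₁ ⊢ₛ A ⇒ᵢ B
        → b ∣ Γ ⊢ₛ A → b ∣ B ∷ Γ ⊢ₛ C → Γ₁ ⊆ Γ → b ∣ Γ ⊢ₛ C
invert⇒ cutA cutB (⇒R d)     ra rb s = cutB (cutA ra d ⊆-refl (∷⁺ʳ _ s)) rb ⊆-refl ⊆-refl
invert⇒ cutA cutB (⊥L m)     ra rb s = ⊥L (s m)
invert⇒ cutA cutB (∧L m d)   ra rb s =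
  ∧L (s m) (invert⇒ cutA cutB d (weaken ⊆-skip₂ ra) (weaken (∷⁺ʳ _ ⊆-skip₂) rb) (keep₂ s))
invert⇒ cutA cutB (∨L m d e) ra rb s =
  ∨L (s m) (invert⇒ cutA cutB d (weaken ⊆-skip ra) (weaken (∷⁺ʳ _ ⊆-skip) rb) (∷⁺ʳ _ s))
           (invert⇒ cutA cutB e (weaken ⊆-skip ra) (weaken (∷⁺ʳ _ ⊆-skip) rb) (∷⁺ʳ _ s))
invert⇒ cutA cutB (⇒L m d e) ra rb s =
  ⇒L (s m) (weaken s d)
     (invert⇒ cutA cutB e (weaken ⊆-skip ra) (weaken (∷⁺ʳ _ ⊆-skip) rb) (∷⁺ʳ _ s))
invert⇒ cutA cutB (K⊥ eq d)  ra rb s = K⊥ eq (weaken (⁺-mono s) d)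

-- For K A the right premise is a K-rule whose premise has already been cut
-- down to  A, known Γ, Γ ⇒ E;  `finish` is that K-rule (KR or K⊥).
invertK : ∀ {E D} → CutFor b A → (∀ {Θ} → b ∣ Θ ⁺ ⊢ₛ E → b ∣ Θ ⊢ₛ D)
        → b ∣ Γ₁ ⊢ₛ Kᵢ A → b ∣ A ∷ Γ ⁺ ⊢ₛ E → Γ₁ ⊆ Γ → b ∣ Γ ⊢ₛ D
invertK cutA finish (KR d)     r s = finish (cutA d r (⁺-mono s) ⊆-refl)
invertK cutA finish (⊥L m)     r s = ⊥L (s m)
invertK cutA finish (∧L m d)   r s =
  ∧L (s m) (invertK cutA finish d (weaken (∷⁺ʳ _ (⁺-mono ⊆-skip₂)) r) (keep₂ s))
invertK cutA finish (∨L m d e) r s =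
  ∨L (s m) (invertK cutA finish d (weaken (∷⁺ʳ _ (⁺-mono ⊆-skip)) r) (∷⁺ʳ _ s))
           (invertK cutA finish e (weaken (∷⁺ʳ _ (⁺-mono ⊆-skip)) r) (∷⁺ʳ _ s))
invertK cutA finish (⇒L m d e) r s =
  ⇒L (s m) (weaken s d) (invertK cutA finish e (weaken (∷⁺ʳ _ (⁺-mono ⊆-skip)) r) (∷⁺ʳ _ s))
invertK cutA finish (K⊥ eq d)  r s = K⊥ eq (weaken (⁺-mono s) d)

pushed : Δ ⊆ A ∷ Γ → B ∷ Δ ⊆ A ∷ B ∷ Γ
pushed s = ⊆-trans (∷⁺ʳ _ s) exchange

-- Cut on A, given cut on its immediate subformulas: induction on the right
-- premise; when A is principal there, invert the left premise.  In the
-- K-rules the cut formula moves into the premise context Δ ⁺, and a formula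
-- K A′ brings A′ along, which is cut first inside `invertK`.
cutFrom : ∀ A → SubCuts b A → CutFor b A
cutFrom A sc d₁ (init m) s₁ s₂ with s₂ m
... | here refl = weaken s₁ d₁
... | there m′  = init m′
cutFrom A sc d₁ (⊥L m) s₁ s₂ with s₂ m
... | here refl = from⊥ d₁ s₁
... | there m′  = ⊥L m′
cutFrom A sc d₁ (∧R a e) s₁ s₂ = ∧R (cutFrom A sc d₁ a s₁ s₂) (cutFrom A sc d₁ e s₁ s₂)
cutFrom A sc d₁ (∨R₁ a)  s₁ s₂ = ∨R₁ (cutFrom A sc d₁ a s₁ s₂)
cutFrom A sc d₁ (∨R₂ a)  s₁ s₂ = ∨R₂ (cutFrom A sc d₁ a s₁ s₂)
cutFrom A sc d₁ (⇒R a)   s₁ s₂ = ⇒R (cutFrom A sc d₁ a (there⊆ s₁) (pushed s₂))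
cutFrom A sc d₁ (∧L m d) s₁ s₂ with s₂ m
... | there m′  = ∧L m′ (cutFrom A sc d₁ d (⊆-trans s₁ ⊆-skip₂) (pushed (pushed s₂)))
... | here refl = invert∧ (proj₁ sc) (proj₂ sc) d₁
                    (cutFrom A sc d₁ d (⊆-trans s₁ ⊆-skip₂) (pushed (pushed s₂))) s₁
cutFrom A sc d₁ (∨L m d e) s₁ s₂ with s₂ m
... | there m′  = ∨L m′ (cutFrom A sc d₁ d (there⊆ s₁) (pushed s₂))
                        (cutFrom A sc d₁ e (there⊆ s₁) (pushed s₂))
... | here refl = invert∨ (proj₁ sc) (proj₂ sc) d₁
                    (cutFrom A sc d₁ d (there⊆ s₁) (pushed s₂))
                    (cutFrom A sc d₁ e (there⊆ s₁) (pushed s₂)) s₁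
cutFrom A sc d₁ (⇒L m a e) s₁ s₂ with s₂ m
... | there m′  = ⇒L m′ (cutFrom A sc d₁ a s₁ s₂) (cutFrom A sc d₁ e (there⊆ s₁) (pushed s₂))
... | here refl = invert⇒ (proj₁ sc) (proj₂ sc) d₁
                    (cutFrom A sc d₁ a s₁ s₂) (cutFrom A sc d₁ e (there⊆ s₁) (pushed s₂)) s₁
cutFrom A sc d₁ (KR d) s₁ s₂ with kview A
... | notK eq = KR (cutFrom A sc d₁ d (⊆-trans s₁ ⊆⁺) (⊆-trans (⁺-mono s₂) (⁺-cons eq)))
... | isK A′  = invertK sc KR d₁
                  (cutFrom (Kᵢ A′) sc d₁ d (there⊆ (⊆-trans s₁ ⊆⁺)) (⊆-trans (⁺-mono s₂) ⁺-consK)) s₁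
cutFrom A sc d₁ (K⊥ eq d) s₁ s₂ with kview A
... | notK eq′ = K⊥ eq (cutFrom A sc d₁ d (⊆-trans s₁ ⊆⁺) (⊆-trans (⁺-mono s₂) (⁺-cons eq′)))
... | isK A′   = invertK sc (K⊥ eq) d₁
                   (cutFrom (Kᵢ A′) sc d₁ d (there⊆ (⊆-trans s₁ ⊆⁺)) (⊆-trans (⁺-mono s₂) ⁺-consK)) s₁

cut : ∀ A → CutFor b A
subCuts : ∀ A → SubCuts b A
cut A = cutFrom A (subCuts A)
subCuts (varᵢ _) = tt
subCuts ⊥ᵢ       = tt
subCuts (A ∧ᵢ B) = cut A , cut B
subCuts (A ∨ᵢ B) = cut A , cut B
subCuts (A ⇒ᵢ B) = cut A , cut B
subCuts (Kᵢ A)   = cut A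

private
  h₀ : A ∈ A ∷ Γ
  h₀ = here refl

  h₁ : A ∈ B ∷ A ∷ Γ
  h₁ = there h₀

  h₂ : A ∈ C ∷ B ∷ A ∷ Γ
  h₂ = there h₁

axiom : IAx b A → b ∣ [] ⊢ₛ A
axiom (ax-K A B)     = ⇒R (⇒R (identity A h₁))
axiom (ax-S A B C)   =
  ⇒R (⇒R (⇒R (⇒L h₂ (identity A h₀)
                    (⇒L (there h₁) (identity A h₁) (⇒L h₁ (identity B h₀) (identity C h₀))))))
axiom (ax-∧E₁ A B)   = ⇒R (∧L h₀ (identity A h₀))
axiom (ax-∧E₂ A B)   = ⇒R (∧L h₀ (identity B h₁))
axiom (ax-∧I A B)    = ⇒R (⇒R (∧R (identity A h₁) (identity B h₀)))
axiom (ax-∨I₁ A B)   = ⇒R (∨R₁ (identity A h₀))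
axiom (ax-∨I₂ A B)   = ⇒R (∨R₂ (identity B h₀))
axiom (ax-∨E A B C)  =
  ⇒R (⇒R (⇒R (∨L h₀ (⇒L (there h₂) (identity A h₀) (identity C h₀))
                     (⇒L (there h₁) (identity B h₀) (identity C h₀)))))
axiom (ax-⊥E A)      = ⇒R (⊥L h₀)
axiom (ax-Kdist A B) = ⇒R (⇒R (KR (⇒L h₁ (identity A h₀) (identity B h₀))))
axiom (ax-co A)      = ⇒R (KR (identity A (⊆⁺ h₀)))
axiom (ax-refl A)    = ⇒R (⇒R (K⊥ refl (⇒L h₁ (identity A h₀) (⊥L h₀))))

-- Every Hilbert-style theorem has a cut-free derivation; modus ponens is a cut.
fromHilbert : b ⊢ᵢ A → b ∣ [] ⊢ₛ A
fromHilbert (ax a) = axiom a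
fromHilbert (mp {A} {B} d e) =
  cut (A ⇒ᵢ B) (fromHilbert d) (⇒L h₀ (weaken (λ ()) (fromHilbert e)) (identity B h₀)) ⊆-refl ⊆-refl

-- Propositional schemata in n metavariables: a small truth-table decision
-- procedure for the classical tautologies used below.
infixr 6 _∧ˢ_
infixr 5 _∨ˢ_
infixr 4 _⇒ˢ_

data Schema (n : ℕ) : Set where
  ‹_›            : Fin n → Schema n
  ⊥ˢ             : Schema n
  _∧ˢ_ _∨ˢ_ _⇒ˢ_ : Schema n → Schema n → Schema n

_[_] : Schema n → Vec LForm n → LForm
‹ i ›      [ σ ] = lookup σ i
⊥ˢ         [ σ ] = ⊥ₗ
(S ∧ˢ S′) [ σ ] = (S [ σ ]) ∧ₗ (S′ [ σ ])
(S ∨ˢ S′) [ σ ] = (S [ σ ]) ∨ₗ (S′ [ σ ])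
(S ⇒ˢ S′) [ σ ] = (S [ σ ]) ⇒ₗ (S′ [ σ ])

⟦_⟧ : Schema n → Vec Bool n → Bool
⟦ ‹ i › ⟧    ρ = lookup ρ i
⟦ ⊥ˢ ⟧       ρ = false
⟦ S ∧ˢ S′ ⟧ ρ = ⟦ S ⟧ ρ ∧ ⟦ S′ ⟧ ρ
⟦ S ∨ˢ S′ ⟧ ρ = ⟦ S ⟧ ρ ∨ ⟦ S′ ⟧ ρ
⟦ S ⇒ˢ S′ ⟧ ρ = not (⟦ S ⟧ ρ) ∨ ⟦ S′ ⟧ ρ

eval-instance : ∀ v (S : Schema n) σ → eval v (S [ σ ]) ≡ ⟦ S ⟧ (map (eval v) σ)
eval-instance v ‹ i ›      σ = sym (lookup-map i (eval v) σ)
eval-instance v ⊥ˢ         σ = refl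
eval-instance v (S ∧ˢ S′) σ = cong₂ _∧_ (eval-instance v S σ) (eval-instance v S′ σ)
eval-instance v (S ∨ˢ S′) σ = cong₂ _∨_ (eval-instance v S σ) (eval-instance v S′ σ)
eval-instance v (S ⇒ˢ S′) σ = cong₂ (λ x y → not x ∨ y) (eval-instance v S σ) (eval-instance v S′ σ)

everywhere : ∀ n → (Vec Bool n → Bool) → Bool
everywhere zero    f = f []
everywhere (suc n) f = everywhere n (λ ρ → f (true ∷ ρ)) ∧ everywhere n (λ ρ → f (false ∷ ρ))

everywhere-sound : ∀ n f → IsTrue (everywhere n f) → ∀ ρ → IsTrue (f ρ)
everywhere-sound zero    f ok []          = ok
everywhere-sound (suc n) f ok (true ∷ ρ)  = everywhere-sound n _ (proj₁ (Equivalence.to T-∧ ok)) ρ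
everywhere-sound (suc n) f ok (false ∷ ρ) = everywhere-sound n _ (proj₂ (Equivalence.to T-∧ ok)) ρ

byTruthTable : (S : Schema n) → IsTrue (everywhere n ⟦ S ⟧) → ∀ σ → Tautology (S [ σ ])
byTruthTable {n} S ok σ v =
  trans (eval-instance v S σ) (Equivalence.to T-≡ (everywhere-sound n ⟦ S ⟧ ok (map (eval v) σ)))

p₀ : Schema (suc n)
p₀ = ‹ # 0 ›

p₁ : Schema (suc (suc n))
p₁ = ‹ # 1 ›

p₂ : Schema (suc (suc (suc n)))
p₂ = ‹ # 2 ›

p₃ : Schema (suc (suc (suc (suc n))))
p₃ = ‹ # 3 ›

taut-id : ∀ {P} → Tautology (P ⇒ₗ P)
taut-id {P} = byTruthTable (p₀ ⇒ˢ p₀) _ (P ∷ [])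

taut-K : ∀ {P G} → Tautology (P ⇒ₗ (G ⇒ₗ P))
taut-K {P} {G} = byTruthTable (p₀ ⇒ˢ p₁ ⇒ˢ p₀) _ (P ∷ G ∷ [])

taut-S : ∀ {G P Q} → Tautology ((G ⇒ₗ (P ⇒ₗ Q)) ⇒ₗ ((G ⇒ₗ P) ⇒ₗ (G ⇒ₗ Q)))
taut-S {G} {P} {Q} = byTruthTable ((p₀ ⇒ˢ p₁ ⇒ˢ p₂) ⇒ˢ (p₀ ⇒ˢ p₁) ⇒ˢ p₀ ⇒ˢ p₂) _ (G ∷ P ∷ Q ∷ [])

taut-trans : ∀ {P Q R} → Tautology ((P ⇒ₗ Q) ⇒ₗ ((Q ⇒ₗ R) ⇒ₗ (P ⇒ₗ R)))
taut-trans {P} {Q} {R} = byTruthTable ((p₀ ⇒ˢ p₁) ⇒ˢ (p₁ ⇒ˢ p₂) ⇒ˢ p₀ ⇒ˢ p₂) _ (P ∷ Q ∷ R ∷ [])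

taut-curry : ∀ {P G Q} → Tautology (((P ∧ₗ G) ⇒ₗ Q) ⇒ₗ (G ⇒ₗ (P ⇒ₗ Q)))
taut-curry {P} {G} {Q} = byTruthTable (((p₀ ∧ˢ p₁) ⇒ˢ p₂) ⇒ˢ p₁ ⇒ˢ p₀ ⇒ˢ p₂) _ (P ∷ G ∷ Q ∷ [])

taut-curry₂ : ∀ {P Q G R} → Tautology (((P ∧ₗ (Q ∧ₗ G)) ⇒ₗ R) ⇒ₗ (G ⇒ₗ (P ⇒ₗ (Q ⇒ₗ R))))
taut-curry₂ {P} {Q} {G} {R} =
  byTruthTable (((p₀ ∧ˢ p₁ ∧ˢ p₂) ⇒ˢ p₃) ⇒ˢ p₂ ⇒ˢ p₀ ⇒ˢ p₁ ⇒ˢ p₃) _ (P ∷ Q ∷ G ∷ R ∷ [])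

taut-weaken : ∀ {G P Q} → Tautology ((G ⇒ₗ P) ⇒ₗ ((Q ∧ₗ G) ⇒ₗ P))
taut-weaken {G} {P} {Q} = byTruthTable ((p₀ ⇒ˢ p₁) ⇒ˢ (p₂ ∧ˢ p₀) ⇒ˢ p₁) _ (G ∷ P ∷ Q ∷ [])

taut-pair : ∀ {P Q} → Tautology (P ⇒ₗ (Q ⇒ₗ (P ∧ₗ Q)))
taut-pair {P} {Q} = byTruthTable (p₀ ⇒ˢ p₁ ⇒ˢ p₀ ∧ˢ p₁) _ (P ∷ Q ∷ [])

taut-fst : ∀ {P Q} → Tautology ((P ∧ₗ Q) ⇒ₗ P)
taut-fst {P} {Q} = byTruthTable (p₀ ∧ˢ p₁ ⇒ˢ p₀) _ (P ∷ Q ∷ [])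

taut-snd : ∀ {P Q} → Tautology ((P ∧ₗ Q) ⇒ₗ Q)
taut-snd {P} {Q} = byTruthTable (p₀ ∧ˢ p₁ ⇒ˢ p₁) _ (P ∷ Q ∷ [])

taut-inl : ∀ {P Q} → Tautology (P ⇒ₗ (P ∨ₗ Q))
taut-inl {P} {Q} = byTruthTable (p₀ ⇒ˢ p₀ ∨ˢ p₁) _ (P ∷ Q ∷ [])

taut-inr : ∀ {P Q} → Tautology (Q ⇒ₗ (P ∨ₗ Q))
taut-inr {P} {Q} = byTruthTable (p₁ ⇒ˢ p₀ ∨ˢ p₁) _ (P ∷ Q ∷ [])

taut-case : ∀ {P Q R} → Tautology ((P ∨ₗ Q) ⇒ₗ ((P ⇒ₗ R) ⇒ₗ ((Q ⇒ₗ R) ⇒ₗ R)))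
taut-case {P} {Q} {R} = byTruthTable (p₀ ∨ˢ p₁ ⇒ˢ (p₀ ⇒ˢ p₂) ⇒ˢ (p₁ ⇒ˢ p₂) ⇒ˢ p₂) _ (P ∷ Q ∷ R ∷ [])

taut-efq : ∀ {P} → Tautology (⊥ₗ ⇒ₗ P)
taut-efq {P} = byTruthTable (⊥ˢ ⇒ˢ p₀) _ (P ∷ [])

taut-mp : Tautology (P ⇒ₗ Q) → Tautology P → Tautology Q
taut-mp {P} {Q} f a v = subst (λ x → not x ∨ eval v Q ≡ true) (a v) (f v)

-- Reasoning inside LPV.  All axioms are internalised by the single constant
-- c₀, and every negative □ will be realised by the single variable x₀.
x₀ : Term
x₀ = pvar 0

c₀ : Term
c₀ = pconst 0

⊤ₗ : LForm
⊤ₗ = ⊥ₗ ⇒ₗ ⊥ₗ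

Fact : Bool → Term → LForm → Set
Fact b t P = b ⊢ₗ (t ∶ P)

Under : Bool → LForm → Term → LForm → Set
Under b G t P = Fact b t (G ⇒ₗ P)

internalTaut : Tautology P → Fact b c₀ P
internalTaut t = nec (ax-taut t) 0

internalAx : LAx b P → Fact b c₀ P
internalAx a = nec a 0

app : Fact b t (P ⇒ₗ Q) → Fact b s P → Fact b (t · s) Q
app {t = t} {P = P} {Q} {s = s} f g = mp (mp (ax (ax-app t s P Q)) f) g

bang : Fact b t P → Fact b (! t) (t ∶ P)
bang {t = t} {P} f = mp (ax (ax-! t P)) f

reflect : Fact b t P → b ⊢ₗ P
reflect {t = t} {P} f = mp (ax (ax-refl t P)) f

identity-fact : ∀ P → Fact b c₀ (P ⇒ₗ P)
identity-fact P = internalTaut (taut-id {P})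

V-intro : Fact b t P → Fact b (c₀ · ! t) (Vₗ P)
V-intro {t = t} {P} f = app (internalAx (ax-V t P)) (bang f)

infixl 7 _⊛_

_⊛_ : Term → Term → Term
t ⊛ s = (c₀ · t) · s

-- proof term of an axiom or tautology under a hypothesis
k₀ : Term
k₀ = c₀ · c₀

always : Fact b t P → Under b G (c₀ · t) P
always {P = P} {G = G} f = app (internalTaut (taut-K {P} {G})) f

under-mp : Under b G t (P ⇒ₗ Q) → Under b G s P → Under b G (t ⊛ s) Q
under-mp {G = G} {P = P} {Q} f g = app (app (internalTaut (taut-S {G} {P} {Q})) f) g

under-ax : LAx b P → Under b G k₀ P
under-ax a = always (internalAx a)

under-taut : Tautology P → Under b G k₀ P
under-taut t = always (internalTaut t)

curry : Fact b t ((P ∧ₗ G) ⇒ₗ Q) → Under b G (c₀ · t) (P ⇒ₗ Q)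
curry {P = P} {G} {Q} f = app (internalTaut (taut-curry {P} {G} {Q})) f

curry₂ : Fact b t ((P ∧ₗ (Q ∧ₗ G)) ⇒ₗ R) → Under b G (c₀ · t) (P ⇒ₗ (Q ⇒ₗ R))
curry₂ {P = P} {Q} {G} {R} f = app (internalTaut (taut-curry₂ {P} {Q} {G} {R})) f

under-weaken : Under b G t P → Under b (Q ∧ₗ G) (c₀ · t) P
under-weaken {G = G} {P = P} {Q = Q} f = app (internalTaut (taut-weaken {G} {P} {Q})) f

under-pair : Under b G t P → Under b G s Q → Under b G ((k₀ ⊛ t) ⊛ s) (P ∧ₗ Q)
under-pair {P = P} {Q = Q} f g = under-mp (under-mp (under-taut (taut-pair {P} {Q})) f) g

under-fst : Under b G t (P ∧ₗ Q) → Under b G (k₀ ⊛ t) P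
under-fst {P = P} {Q} f = under-mp (under-taut (taut-fst {P} {Q})) f

under-snd : Under b G t (P ∧ₗ Q) → Under b G (k₀ ⊛ t) Q
under-snd {P = P} {Q} f = under-mp (under-taut (taut-snd {P} {Q})) f

under-inl : Under b G t P → Under b G (k₀ ⊛ t) (P ∨ₗ Q)
under-inl {P = P} {Q = Q} f = under-mp (under-taut (taut-inl {P} {Q})) f

under-inr : Under b G t Q → Under b G (k₀ ⊛ t) (P ∨ₗ Q)
under-inr {Q = Q} {P = P} f = under-mp (under-taut (taut-inr {P} {Q})) f

under-case : Under b G t (P ∨ₗ Q) → Under b G s (P ⇒ₗ R) → Under b G w (Q ⇒ₗ R)
           → Under b G (((k₀ ⊛ t) ⊛ s) ⊛ w) R
under-case {P = P} {Q} {R = R} f g h = under-mp (under-mp (under-mp (under-taut (taut-case {P} {Q} {R})) f) g) h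

under-compose : Under b G t (P ⇒ₗ Q) → Under b G s (Q ⇒ₗ R) → Under b G ((k₀ ⊛ t) ⊛ s) (P ⇒ₗ R)
under-compose {P = P} {Q} {R = R} f g = under-mp (under-mp (under-taut (taut-trans {P} {Q} {R})) f) g

under-efq : Under b G t ⊥ₗ → Under b G (k₀ ⊛ t) P
under-efq {P = P} f = under-mp (under-taut (taut-efq {P})) f

real : Term → Pol → BForm → LForm
real T π   (varᵦ p) = varₗ p
real T π   ⊥ᵦ       = ⊥ₗ
real T π   (F ∧ᵦ F′) = real T π F ∧ₗ real T π F′
real T π   (F ∨ᵦ F′) = real T π F ∨ₗ real T π F′
real T π   (F ⇒ᵦ F′) = real T (flip π) F ⇒ₗ real T π F′
real T π   (Vᵦ F)   = Vₗ (real T π F)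
real T pos (□ᵦ F)   = T ∶ real T pos F
real T neg (□ᵦ F)   = x₀ ∶ real T neg F

real-normal : ∀ T π F → NormalRealisation π F (real T π F)
real-normal T π   (varᵦ p) = r-var p
real-normal T π   ⊥ᵦ       = r-⊥
real-normal T π   (F ∧ᵦ F′) = r-∧ (real-normal T π F) (real-normal T π F′)
real-normal T π   (F ∨ᵦ F′) = r-∨ (real-normal T π F) (real-normal T π F′)
real-normal T π   (F ⇒ᵦ F′) = r-⇒ (real-normal T (flip π) F) (real-normal T π F′)
real-normal T π   (Vᵦ F)   = r-V (real-normal T π F)
real-normal T pos (□ᵦ F)   = r-□pos T (real-normal T pos F)
real-normal T neg (□ᵦ F)   = r-□neg 0 (real-normal T neg F)

-- The consequent translation: tr (A ⇒ B) = □ (tr A ⇒ trCons B), which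
-- differs from tr B only for B = ⊥ (the clause tr ¬A = □¬tr A).
trCons : IForm → BForm
trCons ⊥ᵢ = ⊥ᵦ
trCons B  = tr B

tr-⇒ : ∀ A B → tr (A ⇒ᵢ B) ≡ □ᵦ (tr A ⇒ᵦ trCons B)
tr-⇒ A ⊥ᵢ       = refl
tr-⇒ A (varᵢ _) = refl
tr-⇒ A (_ ∧ᵢ _) = refl
tr-⇒ A (_ ∨ᵢ _) = refl
tr-⇒ A (_ ⇒ᵢ _) = refl
tr-⇒ A (Kᵢ _)   = refl

Hyp : Term → IForm → LForm
Hyp T B = real T neg (tr B)

Claim : Term → IForm → LForm
Claim T B = real T pos (tr B)

Hyps : Term → List IForm → LForm
Hyps T []      = ⊤ₗ
Hyps T (B ∷ Γ) = Hyp T B ∧ₗ Hyps T Γ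

Sequent : Term → List IForm → IForm → LForm
Sequent T Γ C = Hyps T Γ ⇒ₗ Claim T C

-- Every hypothesis is a negative box, hence of the form x₀ ∶ H.
hyp-boxed : ∀ T B → Σ LForm λ H → Hyp T B ≡ (x₀ ∶ H)
hyp-boxed T (varᵢ p) = _ , refl
hyp-boxed T ⊥ᵢ       = _ , refl
hyp-boxed T (A ∧ᵢ B) = _ , refl
hyp-boxed T (A ∨ᵢ B) = _ , refl
hyp-boxed T (A ⇒ᵢ B) = _ , cong (real T neg) (tr-⇒ A B)
hyp-boxed T (Kᵢ A)   = _ , refl

claim⇒cons : ∀ T B → Fact b c₀ (Claim T B ⇒ₗ real T pos (trCons B))
claim⇒cons T ⊥ᵢ       = internalAx (ax-refl T ⊥ₗ)
claim⇒cons T (varᵢ _) = identity-fact _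
claim⇒cons T (_ ∧ᵢ _) = identity-fact _
claim⇒cons T (_ ∨ᵢ _) = identity-fact _
claim⇒cons T (_ ⇒ᵢ _) = identity-fact _
claim⇒cons T (Kᵢ _)   = identity-fact _

cons⇒hyp : ∀ T B → Fact b c₀ (real T neg (trCons B) ⇒ₗ Hyp T B)
cons⇒hyp T ⊥ᵢ       = internalTaut (taut-efq {Hyp T ⊥ᵢ})
cons⇒hyp T (varᵢ _) = identity-fact _
cons⇒hyp T (_ ∧ᵢ _) = identity-fact _
cons⇒hyp T (_ ∨ᵢ _) = identity-fact _
cons⇒hyp T (_ ⇒ᵢ _) = identity-fact _
cons⇒hyp T (Kᵢ _)   = identity-fact _

hyp-projection : ∀ T {B} Γ → B ∈ Γ → Tautology (Hyps T Γ ⇒ₗ Hyp T B)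
hyp-projection T (B ∷ Γ)  (here refl) = taut-fst {Hyp T B} {Hyps T Γ}
hyp-projection T {B} (B′ ∷ Γ) (there m) =
  taut-mp {Hyps T Γ ⇒ₗ Hyp T B} {(Hyp T B′ ∧ₗ Hyps T Γ) ⇒ₗ Hyp T B}
          (taut-weaken {Hyps T Γ} {Hyp T B} {Hyp T B′}) (hyp-projection T Γ m)

hyp-member : B ∈ Γ → Under b (Hyps T Γ) c₀ (Hyp T B)
hyp-member {Γ = Γ} {T = T} m = internalTaut (hyp-projection T Γ m)

hyp-bang : ∀ T B → Fact b c₀ (Hyp T B ⇒ₗ (! x₀ ∶ Hyp T B))
hyp-bang {b} T B with hyp-boxed T B
... | H , eq = subst (λ F → Fact b c₀ (F ⇒ₗ (! x₀ ∶ F))) (sym eq) (internalAx (ax-! x₀ H))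

-- `Summand k S T`: S occurs in T as a summand, k applications of +ₜ deep.
data Summand : ℕ → Term → Term → Set where
  whole : Summand 0 T T
  left  : Summand k (S +ₜ t) T → Summand (suc k) S T
  right : Summand k (t +ₜ S) T → Summand (suc k) S T

-- The proof term of  S ∶ X → T ∶ X  depends only on the depth of S in T.
liftTerm : ℕ → Term
liftTerm zero    = c₀
liftTerm (suc k) = k₀ · liftTerm k

summand-lift : Summand k S T → ∀ X → Fact b (liftTerm k) ((S ∶ X) ⇒ₗ (T ∶ X))
summand-lift whole X = identity-fact _
summand-lift {S = S} {T = T} (left {t = t} s) X =
  app (app (internalTaut (taut-trans {S ∶ X} {(S +ₜ t) ∶ X} {T ∶ X})) (internalAx (ax-+r t S X)))
      (summand-lift s X)
summand-lift {S = S} {T = T} (right {t = t} s) X =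
  app (app (internalTaut (taut-trans {S ∶ X} {(t +ₜ S) ∶ X} {T ∶ X})) (internalAx (ax-+l t S X)))
      (summand-lift s X)

hypsTerm : List IForm → Term
hypsTerm []      = c₀
hypsTerm (B ∷ Γ) = (c₀ · ! x₀) · hypsTerm Γ

hyps-internalised : ∀ Γ → Σ Term λ e → ∀ T → Under b (Hyps T Γ) e (hypsTerm Γ ∶ Hyps T Γ)
hyps-internalised []      = _ , λ T → always (bang (internalTaut (taut-efq {⊥ₗ})))
hyps-internalised (B ∷ Γ) = _ , λ T →
  let H    = Hyp T B
      Rest = Hyps T Γ
      -- ! x₀ ∶ H, from the hypothesis H = x₀ ∶ _
      bangH = under-mp (always (hyp-bang T B)) (hyp-member (here refl))
      pairH = under-mp (under-mp (under-ax (ax-app c₀ (! x₀) H (Rest ⇒ₗ (H ∧ₗ Rest))))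
                                 (always (bang (internalTaut (taut-pair {H} {Rest})))))
                       bangH
  in under-mp (under-mp (under-ax (ax-app (c₀ · ! x₀) (hypsTerm Γ) Rest (H ∧ₗ Rest))) pairH)
              (under-weaken (proj₂ (hyps-internalised Γ) T))

internalise : ∀ Γ w → Σ Term λ τ → ∀ T P → Under b (Hyps T Γ) w P
            → Under b (Hyps T Γ) τ ((w · hypsTerm Γ) ∶ P)
internalise Γ w = _ , λ T P f →
  under-mp (under-mp (under-ax (ax-app w (hypsTerm Γ) (Hyps T Γ) P)) (always (bang f)))
           (proj₂ (hyps-internalised Γ) T)

onRight : ∀ Γ w k → Σ Term λ τ → ∀ T P → Under b (Hyps T Γ) w P → Summand k (w · hypsTerm Γ) T
        → Under b (Hyps T Γ) τ (T ∶ P)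
onRight Γ w k = _ , λ T P f s → under-mp (always (summand-lift s P)) (proj₂ (internalise Γ w) T P f)

-- Every formula of Γ ⁺ is V-known under the hypotheses Γ: for B ∈ Γ since
-- its hypothesis is checked by ! x₀, for B ∈ known Γ by reflection of
-- x₀ ∶ V B.  (The identity step only makes both proof terms equal.)
knownTerm : Term
knownTerm = k₀ ⊛ (k₀ ⊛ c₀)

known-V : ∀ T Γ {B} → B ∈ Γ ⁺ → Under b (Hyps T Γ) knownTerm (Vₗ (Hyp T B))
known-V T Γ {B} m with ∈-++⁻ (known Γ) m
... | inj₁ m′ = under-mp (under-ax (ax-refl x₀ (Vₗ (Hyp T B))))
                         (under-mp (under-taut (taut-id {x₀ ∶ Vₗ (Hyp T B)})) (hyp-member (known⁻ Γ m′)))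
... | inj₂ m′ = under-mp (under-ax (ax-V (! x₀) (Hyp T B))) (under-mp (always (hyp-bang T B)) (hyp-member m′))

V-conj : ∀ (k : Term) L → Σ Term λ e → ∀ T G → (∀ {B} → B ∈ L → Under b G k (Vₗ (Hyp T B)))
       → Under b G e (Vₗ (Hyps T L))
V-conj k []      = _ , λ T G _ → always (V-intro (internalTaut (taut-efq {⊥ₗ})))
V-conj k (B ∷ L) = _ , λ T G isKnown →
  let H    = Hyp T B
      Rest = Hyps T L
      pairing = under-mp (under-mp (under-ax (ax-Vdist H (Rest ⇒ₗ (H ∧ₗ Rest))))
                                   (always (V-intro (internalTaut (taut-pair {H} {Rest})))))
                         (isKnown (here refl))
  in under-mp (under-mp (under-ax (ax-Vdist Rest (H ∧ₗ Rest))) pairing)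
              (proj₂ (V-conj k L) T G (λ m → isKnown (there m)))

V-lift : ∀ Γ τ → Σ Term λ w → ∀ T P → Fact b τ (Hyps T (Γ ⁺) ⇒ₗ P) → Under b (Hyps T Γ) w (Vₗ P)
V-lift Γ τ = _ , λ T P f →
  under-mp (under-mp (under-ax (ax-Vdist (Hyps T (Γ ⁺)) P)) (always (V-intro f)))
           (proj₂ (V-conj knownTerm (Γ ⁺)) T (Hyps T Γ) (known-V T Γ))

-- A realised derivation of Γ ⇒ C at depth d: one proof term of the
-- realised sequent, valid for every T that contains `summand` d levels deep.
-- Neither term depends on T, which is what allows T to be chosen last.
record Realised (b : Bool) (Γ : List IForm) (C : IForm) (d : ℕ) : Set where
  field
    term    : Term
    summand : Term
    sound   : ∀ T → Summand d summand T → Fact b term (Sequent T Γ C)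
open Realised

-- A right rule (tr C = □ X): prove the realised body X under the hypotheses
-- with some w, and demand w · hypsTerm Γ as a summand of T.
byRightRule : ∀ {X} → tr C ≡ □ᵦ X → (w S : Term)
            → (∀ T → Summand (suc d) S T → Under b (Hyps T Γ) w (real T pos X)) → Realised b Γ C d
byRightRule {C} {d} {b} {Γ} {X} eq w S f = record
  { term    = τ
  ; summand = (w · hypsTerm Γ) +ₜ S
  ; sound   = λ T s → subst (λ F → Fact b τ (Hyps T Γ ⇒ₗ real T pos F)) (sym eq)
                        (lift T (real T pos X) (f T (right s)) (left s))
  }
  where
  τ : Term
  τ = proj₁ (onRight {b = b} Γ w (suc d))

  lift : ∀ T P → Under b (Hyps T Γ) w P → Summand (suc d) (w · hypsTerm Γ) T
       → Under b (Hyps T Γ) τ (T ∶ P)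
  lift = proj₂ (onRight Γ w (suc d))

-- A left rule: prove the claim directly; nothing new is demanded of T.
byLeftRule : (w S : Term) → (∀ T → Summand (suc d) S T → Under b (Hyps T Γ) w (Claim T C))
           → Realised b Γ C d
byLeftRule w S f = record { term = w ; summand = c₀ +ₜ S ; sound = λ T s → f T (right s) }

-- Each rule of the sequent calculus preserves realisability; premises are
-- realised two levels deeper, as summands of the node's second summand.
init-sound : ∀ {p} → varᵢ p ∈ Γ → Realised b Γ (varᵢ p) d
init-sound {p = p} m = byRightRule refl _ c₀ λ T _ →
  under-mp (under-ax (ax-refl x₀ (varₗ p))) (hyp-member m)

⊥L-sound : ⊥ᵢ ∈ Γ → Realised b Γ C d
⊥L-sound m = byLeftRule _ c₀ λ T _ →
  under-efq (under-mp (under-ax (ax-refl x₀ ⊥ₗ)) (hyp-member m))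

∧R-sound : Realised b Γ A (2 + d) → Realised b Γ B (2 + d) → Realised b Γ (A ∧ᵢ B) d
∧R-sound ra re = byRightRule refl _ (summand ra +ₜ summand re) λ T s →
  under-pair (sound ra T (left s)) (sound re T (right s))

∨R₁-sound : Realised b Γ A (2 + d) → Realised b Γ (A ∨ᵢ B) d
∨R₁-sound ra = byRightRule refl _ (summand ra +ₜ c₀) λ T s →
  under-inl (sound ra T (left s))

∨R₂-sound : Realised b Γ B (2 + d) → Realised b Γ (A ∨ᵢ B) d
∨R₂-sound ra = byRightRule refl _ (summand ra +ₜ c₀) λ T s →
  under-inr (sound ra T (left s))

⇒R-sound : Realised b (A ∷ Γ) B (2 + d) → Realised b Γ (A ⇒ᵢ B) d
⇒R-sound {A = A} {B = B} ra = byRightRule (tr-⇒ A B) _ (summand ra +ₜ c₀) λ T s →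
  under-compose (curry (sound ra T (left s))) (always (claim⇒cons T B))

∧L-sound : (A ∧ᵢ B) ∈ Γ → Realised b (A ∷ B ∷ Γ) C (2 + d) → Realised b Γ C d
∧L-sound {A = A} {B = B} m ra = byLeftRule _ (summand ra +ₜ c₀) λ T s →
  let both = under-mp (under-ax (ax-refl x₀ (Hyp T A ∧ₗ Hyp T B))) (hyp-member m)
  in under-mp (under-mp (curry₂ (sound ra T (left s))) (under-fst both)) (under-snd both)

∨L-sound : (A ∨ᵢ B) ∈ Γ → Realised b (A ∷ Γ) C (2 + d) → Realised b (B ∷ Γ) C (2 + d) → Realised b Γ C d
∨L-sound {A = A} {B = B} m ra re = byLeftRule _ (summand ra +ₜ summand re) λ T s →
  let either = under-mp (under-ax (ax-refl x₀ (Hyp T A ∨ₗ Hyp T B))) (hyp-member m)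
  in under-case either (curry (sound ra T (left s))) (curry (sound re T (right s)))

⇒L-sound : (A ⇒ᵢ B) ∈ Γ → Realised b Γ A (2 + d) → Realised b (B ∷ Γ) C (2 + d) → Realised b Γ C d
⇒L-sound {A = A} {B = B} {Γ = Γ} {b = b} m ra re = byLeftRule _ (summand ra +ₜ summand re) λ T s →
  let impl  = subst (Under b (Hyps T Γ) c₀) (cong (real T neg) (tr-⇒ A B)) (hyp-member m)
      modus = under-mp (under-mp (under-ax (ax-refl x₀ _)) impl) (sound ra T (left s))
  in under-mp (curry (sound re T (right s))) (under-mp (always (cons⇒hyp T B)) modus)

KR-sound : Realised b (Γ ⁺) A (2 + d) → Realised b Γ (Kᵢ A) d
KR-sound {Γ = Γ} {A = A} ra = byRightRule refl _ (summand ra +ₜ c₀) λ T s →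
  proj₂ (V-lift Γ (term ra)) T (Claim T A) (sound ra T (left s))

-- For IEL: the premise yields V (T ∶ ⊥), hence V ⊥ and, internalised, a
-- term checking V ⊥ — refuted by the LPV axiom ¬ t ∶ V ⊥.
K⊥-sound : Realised true (Γ ⁺) ⊥ᵢ (2 + d) → Realised true Γ C d
K⊥-sound {Γ = Γ} ra = byLeftRule _ (summand ra +ₜ c₀) λ T s →
  let V⊥T = proj₂ (V-lift Γ (term ra)) T (T ∶ ⊥ₗ) (sound ra T (left s))
      V⊥  = under-mp (under-mp (under-ax (ax-Vdist (T ∶ ⊥ₗ) ⊥ₗ))
                               (always (V-intro (internalAx (ax-refl T ⊥ₗ)))))
                     V⊥T
      checked = proj₂ (internalise Γ _) T (Vₗ ⊥ₗ) V⊥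
  in under-efq (under-mp (under-ax (ax-cons _)) checked)

realise : b ∣ Γ ⊢ₛ C → ∀ d → Realised b Γ C d
realise (init m)     _ = init-sound m
realise (⊥L m)       _ = ⊥L-sound m
realise (∧R a e)     _ = ∧R-sound (realise a _) (realise e _)
realise (∧L m a)     _ = ∧L-sound m (realise a _)
realise (∨R₁ a)      _ = ∨R₁-sound (realise a _)
realise (∨R₂ a)      _ = ∨R₂-sound (realise a _)
realise (∨L m a e)   _ = ∨L-sound m (realise a _) (realise e _)
realise (⇒R a)       _ = ⇒R-sound (realise a _)
realise (⇒L m a e)   _ = ⇒L-sound m (realise a _) (realise e _)
realise (KR a)       _ = KR-sound (realise a _)
realise (K⊥ refl a)  _ = K⊥-sound (realise a _)

-- Closing the loop: take T to be the summand of the root itself; the empty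
-- antecedent is realised as ⊤, so the realised sequent yields (tr F)^r.
realisable : ∀ {F} → b ∣ [] ⊢ₛ F → Σ LForm λ G → NormalRealisation pos (tr F) G × (b ⊢ₗ G)
realisable {F = F} D =
  Claim T₀ F , real-normal T₀ pos (tr F) , mp (reflect (sound r T₀ whole)) (ax (ax-taut (taut-efq {⊥ₗ})))
  where
  r : Realised _ [] F 0
  r = realise D 0

  T₀ : Term
  T₀ = summand r

theorem8 : (∀ (F : IForm) → IEL⁻⊢ F → ProofRealisable⁻ F)
         × (∀ (F : IForm) → IEL⊢ F → ProofRealisable F)
theorem8 = (λ F d → realisable (fromHilbert d)) , (λ F d → realisable (fromHilbert d))
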